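{- Consider a $\gamma$-Colorful $k$-Center instance and a radius $r\ge0$. Let $S\subseteq X$ with $d(s,s')>4r$ for all $s,s'\in S$ with $s\ne s'$, and let $\tau\in\{0,\dots,k-1\}$. If there is a solution $C_1$ of radius $r$ with $|C_1\cap B(S,r)|>\tau$, then there is a solution $C_2$ of radius $2r$ with $|C_2\setminus S|\le k-\tau-1$.
   Context: $\gamma$-Colorful $k$-Center instance: integers $\gamma,k\ge1$, a finite metric space $(X,d)$, subsets $X_\ell\subseteq X$ ($\ell\in[\gamma]$), $m\in\mathbb{Z}_{\ge0}^\gamma$. For $A\subseteq X$, $B(A,r)=\{u\in X:\exists a\in A,\ d(a,u)\le r\}$. A solution of radius $r$ is a set $C\subseteq X$ with $|C|\le k$ and $|B(C,r)\cap X_\ell|\ge m_\ell$ for all $\ell\in[\gamma]$.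
   Formalization: The metric d takes rational values and the radius r is a nonnegative rational. -}

module Defs where

open import Data.Nat using (ℕ; zero; suc)
open import Data.Fin using (Fin)
open import Data.Fin.Properties using (any?)
open import Data.Fin.Subset using (Subset; _∈_; _∩_; ∁; ∣_∣)
open import Data.Fin.Subset.Properties using (_∈?_)
open import Data.Vec using (tabulate)
open import Data.Rational using (ℚ; 0ℚ; _≤_; _<_; _+_)
open import Data.Rational.Properties using (_≤?_)
open import Data.Product using (_×_)
open import Relation.Nullary.Decidable using (⌊_⌋; _×-dec_)
open import Relation.Binary.PropositionalEquality using (_≡_)

record Metric (n : ℕ) : Set where
  field
    dist     : Fin n → Fin n → ℚ
    nonneg   : ∀ x y → 0ℚ ≤ dist x y
    zero⇔eq  : ∀ x y → dist x y ≡ 0ℚ → x ≡ y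
    self     : ∀ x → dist x x ≡ 0ℚ
    symm     : ∀ x y → dist x y ≡ dist y x
    triangle : ∀ x y z → dist x z ≤ dist x y + dist y z

Ball : ∀ {n} → Metric n → Subset n → ℚ → Subset n
Ball M A r = tabulate λ u → ⌊ any? (λ a → (a ∈? A) ×-dec (Metric.dist M a u ≤? r)) ⌋

record Instance (n γ k : ℕ) : Set where
  field
    metric : Metric n
    color  : Fin γ → Subset n
    demand : Fin γ → ℕ

IsSolution : ∀ {n γ k} → Instance n γ k → Subset n → ℚ → Set
IsSolution {k = k} I C r =
  ∣ C ∣ Data.Nat.≤ k × (∀ ℓ → Instance.demand I ℓ Data.Nat.≤ ∣ Ball (Instance.metric I) C r ∩ Instance.color I ℓ ∣)

_∖_ : ∀ {n} → Subset n → Subset n → Subset n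
A ∖ B = A ∩ ∁ B

-- Snap every centre of C₁ lying within r of S to such a point of S, and keep the
-- other centres. Snapping moves a centre by at most r, so the snapped set covers
-- with radius 2r whatever C₁ covered with radius r, and it has at most |C₁| ≤ k
-- points. A centre outside S in the snapped set was never moved, hence lies in
-- C₁ ∖ B(S, r), which has at most |C₁| − (τ + 1) ≤ k − τ − 1 points.
module Submission where

open import Defs
open import Data.Nat using (ℕ; _∸_; _≤_; _<_)
open import Data.Fin using (Fin)
open import Data.Fin.Subset using (Subset; _∈_; _∩_; ∣_∣)
open import Data.Rational using (ℚ; 0ℚ; _+_)
open import Data.Product using (Σ; _×_)
open import Relation.Binary.PropositionalEquality using (_≢_)
import Data.Rational

open import Data.Nat using (suc; z≤n; s≤s)
import Data.Nat as ℕ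
open import Data.Nat.Properties
  using (+-mono-≤; +-monoʳ-≤; n≤1+n; +-suc; +-comm; m+n∸n≡m; ∸-+-assoc; ∸-mono; ≤-trans; ≤-reflexive)
open import Data.Fin using (zero; suc)
open import Data.Fin.Properties using (any?)
open import Data.Fin.Subset using (_∉_; _⊆_; _∪_; ⁅_⁆; ⊥; ∁; inside; outside)
open import Data.Fin.Subset.Properties
  using (_∈?_; ∉⊥; ∣⊥∣≡0; x∈p∩q⁺; x∈p∩q⁻; x∈p∪q⁺; x∈p∪q⁻; x∈⁅x⁆; x∈⁅y⁆⇒x≡y; ∣⁅x⁆∣≡1;
         x∈∁p⇒x∉p; x∉p⇒x∈∁p; p⊆q⇒∣p∣≤∣q∣)
open import Data.Bool using (true)
open import Data.Vec using ([]; _∷_; tabulate; here; there)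
open import Data.Vec.Properties using (lookup∘tabulate; []=⇒lookup; lookup⇒[]=)
open import Data.Product using (∃; _,_; proj₁; proj₂)
open import Data.Sum using (inj₁; inj₂)
open import Function using (_∘_)
open import Data.Rational using () renaming (_≤_ to _≤ℚ_)
import Data.Rational.Properties as ℚₚ
open import Relation.Nullary using (yes; no; does; proof; contradiction)
open import Relation.Nullary.Decidable using (⌊_⌋; isYes≗does; dec-true; _×-dec_)
open import Relation.Nullary.Reflects using (Reflects; invert)
open import Relation.Unary using (Pred; Decidable)
open import Relation.Binary.PropositionalEquality using (_≡_; refl; sym; trans; cong; subst)

private
  variable
    m n γ k : ℕ

∈-tabulate-⌊⌋⁺ : ∀ {p} {P : Pred (Fin n) p} (P? : Decidable P) {u} → P u → u ∈ tabulate (⌊_⌋ ∘ P?)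
∈-tabulate-⌊⌋⁺ P? {u} Pu =
  lookup⇒[]= u _ (trans (lookup∘tabulate (⌊_⌋ ∘ P?) u) (trans (isYes≗does (P? u)) (dec-true (P? u) Pu)))

∈-tabulate-⌊⌋⁻ : ∀ {p} {P : Pred (Fin n) p} (P? : Decidable P) {u} → u ∈ tabulate (⌊_⌋ ∘ P?) → P u
∈-tabulate-⌊⌋⁻ P? {u} u∈ = invert (subst (Reflects _) does≡true (proof (P? u)))
  where
  does≡true : does (P? u) ≡ true
  does≡true = trans (sym (isYes≗does (P? u))) (trans (sym (lookup∘tabulate (⌊_⌋ ∘ P?) u)) ([]=⇒lookup u∈))

∣p∪q∣≤∣p∣+∣q∣ : (p q : Subset n) → ∣ p ∪ q ∣ ≤ ∣ p ∣ ℕ.+ ∣ q ∣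
∣p∪q∣≤∣p∣+∣q∣ []            []            = z≤n
∣p∪q∣≤∣p∣+∣q∣ (inside ∷ p)  (inside ∷ q)  =
  s≤s (≤-trans (∣p∪q∣≤∣p∣+∣q∣ p q) (+-monoʳ-≤ ∣ p ∣ (n≤1+n ∣ q ∣)))
∣p∪q∣≤∣p∣+∣q∣ (inside ∷ p)  (outside ∷ q) = s≤s (∣p∪q∣≤∣p∣+∣q∣ p q)
∣p∪q∣≤∣p∣+∣q∣ (outside ∷ p) (inside ∷ q)  =
  ≤-trans (s≤s (∣p∪q∣≤∣p∣+∣q∣ p q)) (≤-reflexive (sym (+-suc ∣ p ∣ ∣ q ∣)))
∣p∪q∣≤∣p∣+∣q∣ (outside ∷ p) (outside ∷ q) = ∣p∪q∣≤∣p∣+∣q∣ p q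

∣p∖q∣+∣p∩q∣≡∣p∣ : (p q : Subset n) → ∣ p ∖ q ∣ ℕ.+ ∣ p ∩ q ∣ ≡ ∣ p ∣
∣p∖q∣+∣p∩q∣≡∣p∣ []            []            = refl
∣p∖q∣+∣p∩q∣≡∣p∣ (inside ∷ p)  (inside ∷ q)  =
  trans (+-suc ∣ p ∖ q ∣ ∣ p ∩ q ∣) (cong suc (∣p∖q∣+∣p∩q∣≡∣p∣ p q))
∣p∖q∣+∣p∩q∣≡∣p∣ (inside ∷ p)  (outside ∷ q) = cong suc (∣p∖q∣+∣p∩q∣≡∣p∣ p q)
∣p∖q∣+∣p∩q∣≡∣p∣ (outside ∷ p) (_ ∷ q)       = ∣p∖q∣+∣p∩q∣≡∣p∣ p q

∣p∖q∣≡∣p∣∸∣p∩q∣ : (p q : Subset n) → ∣ p ∖ q ∣ ≡ ∣ p ∣ ∸ ∣ p ∩ q ∣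
∣p∖q∣≡∣p∣∸∣p∩q∣ p q =
  trans (sym (m+n∸n≡m ∣ p ∖ q ∣ ∣ p ∩ q ∣)) (cong (_∸ ∣ p ∩ q ∣) (∣p∖q∣+∣p∩q∣≡∣p∣ p q))

image : (Fin m → Fin n) → Subset m → Subset n
image f []            = ⊥
image f (outside ∷ C) = image (f ∘ suc) C
image f (inside ∷ C)  = ⁅ f zero ⁆ ∪ image (f ∘ suc) C

∈-image⁺ : (f : Fin m → Fin n) {C : Subset m} {a : Fin m} → a ∈ C → f a ∈ image f C
∈-image⁺ f               here        = x∈p∪q⁺ (inj₁ (x∈⁅x⁆ (f zero)))
∈-image⁺ f {outside ∷ _} (there a∈C) = ∈-image⁺ (f ∘ suc) a∈C
∈-image⁺ f {inside ∷ _}  (there a∈C) = x∈p∪q⁺ (inj₂ (∈-image⁺ (f ∘ suc) a∈C))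

∈-image⁻ : (f : Fin m → Fin n) (C : Subset m) {u : Fin n} → u ∈ image f C → ∃ λ a → a ∈ C × f a ≡ u
∈-image⁻ f []            u∈ = contradiction u∈ ∉⊥
∈-image⁻ f (outside ∷ C) u∈ with ∈-image⁻ (f ∘ suc) C u∈
... | a , a∈C , fa≡u = suc a , there a∈C , fa≡u
∈-image⁻ f (inside ∷ C)  u∈ with x∈p∪q⁻ ⁅ f zero ⁆ (image (f ∘ suc) C) u∈
... | inj₁ u∈⁅f0⁆ = zero , here , sym (x∈⁅y⁆⇒x≡y (f zero) u∈⁅f0⁆)
... | inj₂ u∈img with ∈-image⁻ (f ∘ suc) C u∈img
...   | a , a∈C , fa≡u = suc a , there a∈C , fa≡u

∣image∣≤∣C∣ : (f : Fin m → Fin n) (C : Subset m) → ∣ image f C ∣ ≤ ∣ C ∣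
∣image∣≤∣C∣ {n = n} f []    = ≤-reflexive (∣⊥∣≡0 n)
∣image∣≤∣C∣ f (outside ∷ C) = ∣image∣≤∣C∣ (f ∘ suc) C
∣image∣≤∣C∣ f (inside ∷ C)  =
  ≤-trans (∣p∪q∣≤∣p∣+∣q∣ ⁅ f zero ⁆ (image (f ∘ suc) C))
          (+-mono-≤ (≤-reflexive (∣⁅x⁆∣≡1 (f zero))) (∣image∣≤∣C∣ (f ∘ suc) C))

module _ (M : Metric n) where
  open Metric M

  ∈-Ball⁺ : ∀ {A r u a} → a ∈ A → dist a u ≤ℚ r → u ∈ Ball M A r
  ∈-Ball⁺ {A} {r} a∈A a≤r = ∈-tabulate-⌊⌋⁺ (λ u → any? λ a → (a ∈? A) ×-dec (dist a u ℚₚ.≤? r)) (_ , a∈A , a≤r)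

  ∈-Ball⁻ : ∀ {A r u} → u ∈ Ball M A r → ∃ λ a → a ∈ A × dist a u ≤ℚ r
  ∈-Ball⁻ {A} {r} = ∈-tabulate-⌊⌋⁻ (λ u → any? λ a → (a ∈? A) ×-dec (dist a u ℚₚ.≤? r))

  Ball-⊆-image : (g : Fin n → Fin n) {ρ r : ℚ} → (∀ a → dist (g a) a ≤ℚ ρ) →
                 ∀ C → Ball M C r ⊆ Ball M (image g C) (ρ + r)
  Ball-⊆-image g g-close C u∈ with ∈-Ball⁻ u∈
  ... | a , a∈C , a≤r = ∈-Ball⁺ (∈-image⁺ g a∈C)
    (ℚₚ.≤-trans (triangle (g a) a _) (ℚₚ.+-mono-≤ (g-close a) a≤r))

  module Snap (S : Subset n) (r : ℚ) where

    snap : Fin n → Fin n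
    snap t with t ∈? Ball M S r
    ... | yes t∈B = proj₁ (∈-Ball⁻ t∈B)
    ... | no  _   = t

    snap-inside : ∀ {t} → t ∈ Ball M S r → snap t ∈ S
    snap-inside {t} t∈B with t ∈? Ball M S r
    ... | yes t∈B′ = proj₁ (proj₂ (∈-Ball⁻ t∈B′))
    ... | no  t∉B  = contradiction t∈B t∉B

    snap-outside : ∀ {t} → t ∉ Ball M S r → snap t ≡ t
    snap-outside {t} t∉B with t ∈? Ball M S r
    ... | yes t∈B = contradiction t∈B t∉B
    ... | no  _   = refl

    dist-snap : 0ℚ ≤ℚ r → ∀ t → dist (snap t) t ≤ℚ r
    dist-snap 0≤r t with t ∈? Ball M S r
    ... | yes t∈B = proj₂ (proj₂ (∈-Ball⁻ t∈B))
    ... | no  _   = subst (_≤ℚ r) (sym (self t)) 0≤r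

    image-snap∖S⊆∖Ball : ∀ C → image snap C ∖ S ⊆ C ∖ Ball M S r
    image-snap∖S⊆∖Ball C u∈ with x∈p∩q⁻ (image snap C) (∁ S) u∈
    ... | u∈img , u∈∁S with ∈-image⁻ snap C u∈img
    ... | a , a∈C , snap-a≡u = subst (_∈ C ∖ Ball M S r) (trans (sym (snap-outside a∉B)) snap-a≡u)
                                     (x∈p∩q⁺ (a∈C , x∉p⇒x∈∁p a∉B))
      where
      a∉B : a ∉ Ball M S r
      a∉B a∈B = x∈∁p⇒x∉p u∈∁S (subst (_∈ S) snap-a≡u (snap-inside a∈B))

IsSolution-mono : (I : Instance n γ k) {C C′ : Subset n} {r r′ : ℚ} → IsSolution I C r → ∣ C′ ∣ ≤ ∣ C ∣ →
                  Ball (Instance.metric I) C r ⊆ Ball (Instance.metric I) C′ r′ → IsSolution I C′ r′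
IsSolution-mono I (∣C∣≤k , covers) ∣C′∣≤∣C∣ B⊆B′ =
  ≤-trans ∣C′∣≤∣C∣ ∣C∣≤k ,
  λ ℓ → ≤-trans (covers ℓ) (p⊆q⇒∣p∣≤∣q∣ λ u∈ → let u∈B , u∈X = x∈p∩q⁻ _ _ u∈ in x∈p∩q⁺ (B⊆B′ u∈B , u∈X))

lemma2 : ∀ {n γ k} → 1 ≤ γ → 1 ≤ k → (I : Instance n γ k) → (r : ℚ) → 0ℚ Data.Rational.≤ r →
    (S : Subset n) →
    (∀ s s' → s ∈ S → s' ∈ S → s ≢ s' → (r + r) + (r + r) Data.Rational.< Metric.dist (Instance.metric I) s s') →
    (τ : ℕ) → τ < k →
    Σ (Subset n) (λ C₁ → IsSolution I C₁ r × τ < ∣ C₁ ∩ Ball (Instance.metric I) S r ∣) →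
    Σ (Subset n) (λ C₂ → IsSolution I C₂ (r + r) × ∣ C₂ ∖ S ∣ ≤ k ∸ τ ∸ 1)
lemma2 {k = k} _ _ I r 0≤r S _ τ _ (C₁ , sol₁@(∣C₁∣≤k , _) , τ<∣C₁∩B∣) =
  image snap C₁ ,
  IsSolution-mono I sol₁ (∣image∣≤∣C∣ snap C₁) (Ball-⊆-image M snap (dist-snap 0≤r) C₁) ,
  (begin
    ∣ image snap C₁ ∖ S ∣         ≤⟨ p⊆q⇒∣p∣≤∣q∣ (image-snap∖S⊆∖Ball C₁) ⟩
    ∣ C₁ ∖ Ball M S r ∣           ≡⟨ ∣p∖q∣≡∣p∣∸∣p∩q∣ C₁ (Ball M S r) ⟩
    ∣ C₁ ∣ ∸ ∣ C₁ ∩ Ball M S r ∣  ≤⟨ ∸-mono ∣C₁∣≤k τ<∣C₁∩B∣ ⟩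
    k ∸ suc τ                     ≡⟨ cong (k ∸_) (+-comm 1 τ) ⟩
    k ∸ (τ ℕ.+ 1)                 ≡⟨ ∸-+-assoc k τ 1 ⟨
    k ∸ τ ∸ 1                     ∎)
  where
  M = Instance.metric I
  open Snap M S r
  open Data.Nat.Properties.≤-Reasoning
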